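{- Let $p$ be a prime and $n\ge1$. For $0\le a\le p^n-1$ let $[a,a+1]$ denote the Farey triangle with vertices $0/1$, $1/a$, $1/(a+1)$ (with $1/0=\infty$). Two distinct such triangles $[a,a+1]$ and $[b,b+1]$ are $\Gamma_0(p^n)$-equivalent if and only if $p^n$ divides $a(b+1)+1$ or $b(a+1)+1$. In particular, $[a-1,a]\sim[a,a+1]$ if and only if $a^2\equiv 0$ or $a^2\equiv -1 \pmod{p^n}$.
   Context: $\Gamma_0(N)$ is the subgroup of $PSL(2,\mathbb Z)$ of matrices with $(2,1)$-entry divisible by $N$, acting on $\mathbb Q\cup\{\infty\}$ by Möbius transformations. Two distinct triangles $[a,a+1]$ and $[b,b+1]$ are called $\Gamma_0(p^n)$-equivalent ($[a,a+1]\sim[b,b+1]$) if there is $\gamma\in\Gamma_0(p^n)$ with either $\gamma(0/1)=1/(b+1)$, $\gamma(1/a)=0/1$, $\gamma(1/(a+1))=1/b$, or $\gamma(0/1)=1/b$, $\gamma(1/a)=1/(b+1)$, $\gamma(1/(a+1))=0/1$. -}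

module Defs where

open import Data.Nat using (ℕ; suc)
open import Data.Integer using (ℤ; +_; _+_; _*_; _-_; +0)
open import Data.Integer.Divisibility using (_∣_)
open import Data.Product using (_×_; _,_)
open import Data.Sum using (_⊎_)
open import Relation.Binary.PropositionalEquality using (_≡_)

-- Points of ℚ ∪ {∞} = P¹(ℚ) represented by homogeneous integer coordinates
-- (x , y) standing for x/y (with (x , 0) = ∞); coordinates are not both zero.
P1 : Set
P1 = ℤ × ℤ

_≈P_ : P1 → P1 → Set
(x , y) ≈P (x' , y') = x * y' ≡ x' * y

-- Elements of Γ₀(N): integer matrices (α β ; γ δ) of determinant 1 with
-- N ∣ γ.  (An element of PSL(2,ℤ) is ±M; both signs act identically on
-- P¹(ℚ), so quantifying over SL(2,ℤ)-representatives is the same.)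
record Γ₀ (N : ℕ) : Set where
  constructor mat
  field
    α β γ δ : ℤ
    det≡1   : α * δ - β * γ ≡ + 1
    N∣γ     : (+ N) ∣ γ

act : ∀ {N} → Γ₀ N → P1 → P1
act g (x , y) = (α * x + β * y , γ * x + δ * y)
  where open Γ₀ g

zeroP : P1
zeroP = (+0 , + 1)

inv : ℕ → P1
inv k = (+ 1 , + k)

TriEquiv : ℕ → ℕ → ℕ → Set
TriEquiv N a b =
  Data.Product.Σ (Γ₀ N) λ g →
    (act g zeroP ≈P inv (suc b) × act g (inv a) ≈P zeroP × act g (inv (suc a)) ≈P inv b)
    ⊎ (act g zeroP ≈P inv b × act g (inv a) ≈P inv (suc b) × act g (inv (suc a)) ≈P zeroP)

{-# OPTIONS --safe #-}
module Submission where

-- A matrix g = (α β; γ δ) carrying [a,a+1] onto [b,b+1] is pinned down, up to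
-- the scalar β, by the images of the three vertices: it is β·M(u,v) with
-- M(u,v) = (−u 1; −(uv+1) v), where (u,v) = (a,b+1) if g(1/a) = 0 and
-- (u,v) = (a+1,b) if g(1/(a+1)) = 0.  Since det M(u,v) = 1, det g = β² = 1,
-- so the lower-left entry of g is ∓(uv+1); conversely M(u,v) itself lies in
-- Γ₀(N) as soon as N ∣ uv+1.  Hence the criterion holds for every level N,
-- and for the triangles [a−1,a], [a,a+1] the two values of uv+1 are a² and
-- a²+1.

open import Defs

module TriangleMaps where

  open import Data.Integer using (ℤ; +_; -_; 0ℤ; 1ℤ; _+_; _*_; _-_; ∣_∣)
  open import Data.Integer.Divisibility using (_∣_)
  open import Data.Integer.Properties using (i-j≡0⇒i≡j; +-inverseʳ; *-zeroˡ; abs-*; ∣-i∣≡∣i∣; pos-*)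
  open import Data.Integer.Tactic.RingSolver using (solve)
  open import Data.List using (_∷_; [])
  open import Data.Nat using (ℕ; suc)
  import Data.Nat as ℕ
  import Data.Nat.Divisibility as ℕ
  open import Data.Product using (_×_; _,_)
  open import Data.Sum using (_⊎_; inj₁; inj₂)
  open import Function.Bundles using (_⇔_; mk⇔)
  open import Relation.Binary.PropositionalEquality using (_≡_; refl; sym; trans; cong; subst; subst₂)

  -- Reduces deriving a consequence X ≡ Y of L ≡ R to a ring identity.
  ≡-from-multiple : ∀ {L R X Y : ℤ} → L ≡ R → (c : ℤ) → X - Y ≡ (L - R) * c → X ≡ Y
  ≡-from-multiple {L} {_} {X} {Y} refl c X-Y≡0*c =
    i-j≡0⇒i≡j X Y (trans X-Y≡0*c (trans (cong (_* c) (+-inverseʳ L)) (*-zeroˡ c)))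

  SendsTo : (α β γ δ x y x′ y′ : ℤ) → Set
  SendsTo α β γ δ x y x′ y′ = (α * x + β * y) * y′ ≡ x′ * (γ * x + δ * y)

  -- The two alternatives of TriEquiv for the matrix (α β; γ δ), with a and b
  -- generalised to integers A and B; written on the entries rather than through
  -- act so that the ring solver sees them.
  Sends₁ Sends₂ : (α β γ δ A B : ℤ) → Set
  Sends₁ α β γ δ A B = SendsTo α β γ δ 0ℤ 1ℤ 1ℤ (1ℤ + B)
                     × SendsTo α β γ δ 1ℤ A 0ℤ 1ℤ
                     × SendsTo α β γ δ 1ℤ (1ℤ + A) 1ℤ B
  Sends₂ α β γ δ A B = SendsTo α β γ δ 0ℤ 1ℤ 1ℤ B
                     × SendsTo α β γ δ 1ℤ A 1ℤ (1ℤ + B)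
                     × SendsTo α β γ δ 1ℤ (1ℤ + A) 0ℤ 1ℤ

  record IsScaledTriangleMatrix (α β γ δ u v : ℤ) : Set where
    constructor isScaledTriangleMatrix
    field
      α≡ : α ≡ - (β * u)
      γ≡ : γ ≡ - (β * (u * v + 1ℤ))
      δ≡ : δ ≡ β * v

  triangleMatrix-sends₁ : ∀ A B → Sends₁ (- A) 1ℤ (- (A * (1ℤ + B) + 1ℤ)) (1ℤ + B) A B
  triangleMatrix-sends₁ A B = solve (A ∷ B ∷ []) , solve (A ∷ B ∷ []) , solve (A ∷ B ∷ [])

  triangleMatrix-sends₂ : ∀ A B → Sends₂ (- (1ℤ + A)) 1ℤ (- ((1ℤ + A) * B + 1ℤ)) B A B
  triangleMatrix-sends₂ A B = solve (A ∷ B ∷ []) , solve (A ∷ B ∷ []) , solve (A ∷ B ∷ [])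

  sends₁⇒scaled : ∀ {α β γ δ A B} → Sends₁ α β γ δ A B →
                  IsScaledTriangleMatrix α β γ δ A (1ℤ + B)
  sends₁⇒scaled {α} {β} {γ} {δ} {A} {B} (h₀ , h₁ , h₂) = isScaledTriangleMatrix α≡ γ≡ δ≡
    where
    α≡ : α ≡ - (β * A)
    α≡ = ≡-from-multiple h₁ 1ℤ (solve (α ∷ β ∷ γ ∷ δ ∷ A ∷ []))
    δ≡ : δ ≡ β * (1ℤ + B)
    δ≡ = ≡-from-multiple h₀ (- 1ℤ) (solve (α ∷ β ∷ γ ∷ δ ∷ B ∷ []))
    h₂′ : SendsTo (- (β * A)) β γ (β * (1ℤ + B)) 1ℤ (1ℤ + A) 1ℤ B
    h₂′ = subst₂ (λ α′ δ′ → SendsTo α′ β γ δ′ 1ℤ (1ℤ + A) 1ℤ B) α≡ δ≡ h₂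
    γ≡ : γ ≡ - (β * (A * (1ℤ + B) + 1ℤ))
    γ≡ = ≡-from-multiple h₂′ (- 1ℤ) (solve (β ∷ γ ∷ A ∷ B ∷ []))

  sends₂⇒scaled : ∀ {α β γ δ A B} → Sends₂ α β γ δ A B →
                  IsScaledTriangleMatrix α β γ δ (1ℤ + A) B
  sends₂⇒scaled {α} {β} {γ} {δ} {A} {B} (h₀ , h₁ , h₂) = isScaledTriangleMatrix α≡ γ≡ δ≡
    where
    α≡ : α ≡ - (β * (1ℤ + A))
    α≡ = ≡-from-multiple h₂ 1ℤ (solve (α ∷ β ∷ γ ∷ δ ∷ A ∷ []))
    δ≡ : δ ≡ β * B
    δ≡ = ≡-from-multiple h₀ (- 1ℤ) (solve (α ∷ β ∷ γ ∷ δ ∷ B ∷ []))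
    h₁′ : SendsTo (- (β * (1ℤ + A))) β γ (β * B) 1ℤ A 1ℤ (1ℤ + B)
    h₁′ = subst₂ (λ α′ δ′ → SendsTo α′ β γ δ′ 1ℤ A 1ℤ (1ℤ + B)) α≡ δ≡ h₁
    γ≡ : γ ≡ - (β * ((1ℤ + A) * B + 1ℤ))
    γ≡ = ≡-from-multiple h₁′ (- 1ℤ) (solve (β ∷ γ ∷ A ∷ B ∷ []))

  scaled-unimodular⇒βγ≡-[uv+1] : ∀ {α β γ δ u v} → IsScaledTriangleMatrix α β γ δ u v →
                                 α * δ - β * γ ≡ 1ℤ → β * γ ≡ - (u * v + 1ℤ)
  scaled-unimodular⇒βγ≡-[uv+1] {β = β} {u = u} {v = v}
                               (isScaledTriangleMatrix refl refl refl) det = βγ≡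
    where
    -- det restated in unnormalised form, which the ring solver needs.
    det′ : - (β * u) * (β * v) - β * - (β * (u * v + 1ℤ)) ≡ 1ℤ
    det′ = det
    β²≡1 : β * β ≡ 1ℤ
    β²≡1 = ≡-from-multiple det′ 1ℤ (solve (β ∷ u ∷ v ∷ []))
    βγ≡ : β * - (β * (u * v + 1ℤ)) ≡ - (u * v + 1ℤ)
    βγ≡ = ≡-from-multiple β²≡1 (- (u * v + 1ℤ)) (solve (β ∷ u ∷ v ∷ []))

  module _ {N : ℕ} where

    triangleMatrix : (u v : ℤ) → + N ∣ u * v + 1ℤ → Γ₀ N
    triangleMatrix u v N∣uv+1 =
      mat (- u) 1ℤ (- (u * v + 1ℤ)) v (solve (u ∷ v ∷ []))
          (subst (ℕ._∣_ N) (sym (∣-i∣≡∣i∣ (u * v + 1ℤ))) N∣uv+1)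

    scaled⇒∣ : ∀ (g : Γ₀ N) {u v} → let open Γ₀ g in
               IsScaledTriangleMatrix α β γ δ u v → + N ∣ u * v + 1ℤ
    scaled⇒∣ (mat α β γ δ det N∣γ) {u} {v} scaled = begin
      N                 ∣⟨ N∣γ ⟩
      ∣ γ ∣             ∣⟨ ℕ.n∣m*n ∣ β ∣ ⟩
      ∣ β ∣ ℕ.* ∣ γ ∣   ≡⟨ abs-* β γ ⟨
      ∣ β * γ ∣         ≡⟨ cong ∣_∣ (scaled-unimodular⇒βγ≡-[uv+1] scaled det) ⟩
      ∣ - w ∣           ≡⟨ ∣-i∣≡∣i∣ w ⟩
      ∣ w ∣             ∎
      where
      open ℕ.∣-Reasoning
      w : ℤ
      w = u * v + 1ℤ

    triEquiv⇔∣ : ∀ a b →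
                 TriEquiv N a b ⇔ ((+ N ∣ + a * + suc b + 1ℤ) ⊎ (+ N ∣ + suc a * + b + 1ℤ))
    triEquiv⇔∣ a b = mk⇔ to from
      where
      to : TriEquiv N a b → (+ N ∣ + a * + suc b + 1ℤ) ⊎ (+ N ∣ + suc a * + b + 1ℤ)
      to (g , inj₁ s) = inj₁ (scaled⇒∣ g (sends₁⇒scaled s))
      to (g , inj₂ s) = inj₂ (scaled⇒∣ g (sends₂⇒scaled s))
      from : (+ N ∣ + a * + suc b + 1ℤ) ⊎ (+ N ∣ + suc a * + b + 1ℤ) → TriEquiv N a b
      from (inj₁ d) = triangleMatrix (+ a) (+ suc b) d , inj₁ (triangleMatrix-sends₁ (+ a) (+ b))
      from (inj₂ d) = triangleMatrix (+ suc a) (+ b) d , inj₂ (triangleMatrix-sends₂ (+ a) (+ b))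

    ∣-pos⇔∣ : ∀ u v {m} → u ℕ.* v ℕ.+ 1 ≡ m → + N ∣ + u * + v + 1ℤ ⇔ N ℕ.∣ m
    ∣-pos⇔∣ u v refl = mk⇔ (subst (ℕ._∣_ N) abs≡) (subst (ℕ._∣_ N) (sym abs≡))
      where
      abs≡ : ∣ + u * + v + 1ℤ ∣ ≡ u ℕ.* v ℕ.+ 1
      abs≡ = cong (λ x → ∣ x + 1ℤ ∣) (sym (pos-* u v))

open TriangleMaps using (triEquiv⇔∣; ∣-pos⇔∣)

open import Data.Nat using (ℕ; suc; _+_; _*_; _^_; _<_; _∸_; _≤_)
open import Data.Nat.Divisibility using (_∣_)
open import Data.Nat.Primality using (Prime)
open import Data.Product using (_×_)
open import Data.Sum using (_⊎_)
open import Function.Bundles using (_⇔_)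
open import Relation.Binary.PropositionalEquality using (_≢_)

open import Data.List using (_∷_; [])
open import Data.Nat.Tactic.RingSolver using (solve)
open import Data.Product using (_,_)
open import Data.Sum.Function.Propositional using (_⊎-⇔_)
import Function.Properties.Equivalence as ⇔
open import Relation.Binary.PropositionalEquality using (_≡_; subst₂)

triEquiv⇔ : ∀ N a b → TriEquiv N a b ⇔ ((N ∣ a * (b + 1) + 1) ⊎ (N ∣ b * (a + 1) + 1))
triEquiv⇔ N a b = ⇔.trans (triEquiv⇔∣ a b)
  (∣-pos⇔∣ a (suc b) first≡ ⊎-⇔ ∣-pos⇔∣ (suc a) b second≡)
  where
  first≡ : a * suc b + 1 ≡ a * (b + 1) + 1
  first≡ = solve (a ∷ b ∷ [])
  second≡ : suc a * b + 1 ≡ b * (a + 1) + 1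
  second≡ = solve (a ∷ b ∷ [])

lemma11p1 : (p n : ℕ) → Prime p → 1 ≤ n →
    ((a b : ℕ) → a < p ^ n → b < p ^ n → a ≢ b →
      (TriEquiv (p ^ n) a b ⇔ ((p ^ n ∣ a * (b + 1) + 1) ⊎ (p ^ n ∣ b * (a + 1) + 1))))
    × ((a : ℕ) → 1 ≤ a → a < p ^ n →
      (TriEquiv (p ^ n) (a ∸ 1) a ⇔ ((p ^ n ∣ a * a) ⊎ (p ^ n ∣ a * a + 1))))
lemma11p1 p n _ _ = (λ a b _ _ _ → triEquiv⇔ (p ^ n) a b) , adjacent
  where
  adjacent : (a : ℕ) → 1 ≤ a → a < p ^ n →
             TriEquiv (p ^ n) (a ∸ 1) a ⇔ ((p ^ n ∣ a * a) ⊎ (p ^ n ∣ a * a + 1))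
  adjacent (suc c) _ _ =
    subst₂ (λ x y → TriEquiv (p ^ n) c (suc c) ⇔ ((p ^ n ∣ x) ⊎ (p ^ n ∣ y)))
      first≡a² second≡a²+1 (triEquiv⇔ (p ^ n) c (suc c))
    where
    first≡a² : c * (suc c + 1) + 1 ≡ suc c * suc c
    first≡a² = solve (c ∷ [])
    second≡a²+1 : suc c * (c + 1) + 1 ≡ suc c * suc c + 1
    second≡a²+1 = solve (c ∷ [])
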